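{- Let $p>11$ be a prime with $p\equiv 5\pmod 6$, let $S=\{x\in\{1,2,\dots,\frac{p-5}{6}\}: x\equiv 1\pmod 3\}\subseteq\mathbb{F}_p$, and let $G_p$ be the graph with vertex set $V=S\times\mathbb{F}_p\times\mathbb{F}_p$ in which $x=(x_1,x_2,x_3)$ and $y=(y_1,y_2,y_3)$ are adjacent if and only if $x\ne y$, $x_2+y_3=x_1y_1^{2}$ and $x_3+y_2=x_1^{2}y_1$. Let $a,b,c\in V$ be pairwise distinct, and let $x,y,z,w\in V$ be pairwise distinct such that $ax,xw,by,yw,cz,zw$ are all edges of $G_p$. Then: (1) if $a_1=b_1$, then $a_2\ne b_2$ and $a_3\ne b_3$; (2) if $a_1=c_1$, then $a_2\ne c_2$ and $a_3\ne c_3$; (3) if $b_1=c_1$, then $b_2\ne c_2$ and $b_3\ne c_3$.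
   Context: Coordinates of a vertex $v\in V$ are written $v=(v_1,v_2,v_3)$. -}

module Defs where

open import Data.Nat using (ℕ; suc; _+_; _*_; _∸_; _≤_; _<_; NonZero)
open import Data.Nat.DivMod using (_/_; _%_; _mod_)
open import Data.Nat.Primality using (Prime)
open import Data.Fin using (Fin; toℕ)

open import Data.Product using (_×_; _,_; Σ)
open import Relation.Binary.PropositionalEquality using (_≡_)
open import Relation.Nullary using (¬_)

F : ℕ → Set
F p = Fin p

module Field (p : ℕ) .{{_ : NonZero p}} where
  infixl 6 _⊕_
  infixl 7 _⊗_
  _⊕_ : Fin p → Fin p → Fin p
  a ⊕ b = (toℕ a + toℕ b) mod p
  _⊗_ : Fin p → Fin p → Fin p
  a ⊗ b = (toℕ a * toℕ b) mod p
  ι : ℕ → Fin p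
  ι n = n mod p

InS : ℕ → ℕ → Set
InS p x = (1 ≤ x) × (x ≤ (p ∸ 5) / 6) × (x % 3 ≡ 1)

-- Vertices of G_p: triples (v₁, v₂, v₃) with v₁ ∈ S (as a natural number
-- 1 ≤ v₁ ≤ (p-5)/6 < p, embedded into F_p), v₂, v₃ ∈ F_p.
record Vertex (p : ℕ) : Set where
  constructor vtx
  field
    v₁ : ℕ
    inS : InS p v₁
    v₂ : Fin p
    v₃ : Fin p
open Vertex public

SameVertex : {p : ℕ} → Vertex p → Vertex p → Set
SameVertex x y = (v₁ x ≡ v₁ y) × (v₂ x ≡ v₂ y) × (v₃ x ≡ v₃ y)

Adj : (p : ℕ) .{{_ : NonZero p}} → Vertex p → Vertex p → Set
Adj p x y =
  (¬ SameVertex x y) ×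
  (v₂ x ⊕ v₃ y ≡ ι (v₁ x) ⊗ ι (v₁ y) ⊗ ι (v₁ y)) ×
  (v₃ x ⊕ v₂ y ≡ ι (v₁ x) ⊗ ι (v₁ x) ⊗ ι (v₁ y))
  where open Field p

{-# OPTIONS --safe #-}
-- Let a₁ = b₁ = α and let a–x–w, b–y–w be paths. Subtracting the adjacency equations along
-- the two paths gives, in F_p,
--   a₂ − b₂ = (α − w₁)(x₁ − y₁)(x₁ + y₁)   and   a₃ − b₃ = (α − w₁)(x₁ − y₁)(α + w₁).
-- Elements of S are positive and at most (p − 5)/6, so x₁ + y₁ and α + w₁ are nonzero in F_p,
-- whence a₂ = b₂ ⟺ (α − w₁)(x₁ − y₁) = 0 ⟺ a₃ = b₃; either equality would force a = b.
-- The computation is done on integer representatives, equality in F_p becoming divisibility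
-- by p.
module Submission where

open import Defs
open import Data.Nat using (ℕ; suc; _<_; _%_; NonZero)
open import Data.Nat.Primality using (Prime)
open import Data.Product using (_×_)
open import Relation.Binary.PropositionalEquality using (_≡_; _≢_)
open import Relation.Nullary using (¬_)

open import Data.Nat as ℕ using (zero; _≤_; _∸_; _/_; s≤s; z≤n)
import Data.Nat.Properties as ℕ
open import Data.Nat.DivMod using (m≡m%n+[m/n]*n; %-distribˡ-*; m/n*n≤m)
open import Data.Nat.Divisibility using (>⇒∤) renaming (_∣_ to _∣ℕ_)
open import Data.Nat.Primality using (euclidsLemma)
import Data.Nat.Tactic.RingSolver as ℕ-Solver
open import Data.Integer as ℤ using (ℤ; +_; 0ℤ; _+_; _-_; _*_)
import Data.Integer.Properties as ℤ
open import Data.Integer.Divisibility.Signed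
open import Data.Integer.Tactic.RingSolver using (solve-∀)
open import Data.Fin using (Fin; toℕ)
open import Data.Fin.Properties using (toℕ-fromℕ<; toℕ<n; toℕ-injective)
open import Data.Sum using (_⊎_; inj₁; inj₂)
open import Data.Product using (_,_; proj₁; proj₂)
open import Function.Bundles using (_⇔_; mk⇔; Equivalence)
import Function.Properties.Equivalence as ⇔
open import Relation.Binary.PropositionalEquality
  using (refl; sym; trans; cong; cong₂; subst; module ≡-Reasoning)
open import Relation.Nullary using (contradiction)
open import Level using (0ℓ)
import Relation.Binary.Reasoning.Setoid as SetoidReasoning

private variable
  p : ℕ

prime-∣-* : Prime p → ∀ i j → + p ∣ i * j → + p ∣ i ⊎ + p ∣ j
prime-∣-* {p} pp i j p∣ij with euclidsLemma ℤ.∣ i ∣ ℤ.∣ j ∣ pp (subst (p ∣ℕ_) (ℤ.abs-* i j) (∣⇒∣ᵤ p∣ij))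
... | inj₁ p∣i = inj₁ (∣ᵤ⇒∣ p∣i)
... | inj₂ p∣j = inj₂ (∣ᵤ⇒∣ p∣j)

∣-cancel-factor : Prime p → ∀ {u t s} → ¬ + p ∣ s → + p ∣ u - t * s → + p ∣ u ⇔ + p ∣ t
∣-cancel-factor {p} pp {u} {t} {s} p∤s p∣u-ts = mk⇔ to from
  where
  u-[u-ts]≡ts : ∀ u t s → u - (u - t * s) ≡ t * s
  u-[u-ts]≡ts = solve-∀
  [u-ts]+ts≡u : ∀ u t s → (u - t * s) + t * s ≡ u
  [u-ts]+ts≡u = solve-∀
  to : + p ∣ u → + p ∣ t
  to p∣u with prime-∣-* pp t s (subst (+ p ∣_) (u-[u-ts]≡ts u t s) (∣m∣n⇒∣m-n p∣u p∣u-ts))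
  ... | inj₁ p∣t = p∣t
  ... | inj₂ p∣s = contradiction p∣s p∤s
  from : + p ∣ t → + p ∣ u
  from p∣t = subst (+ p ∣_) ([u-ts]+ts≡u u t s) (∣m∣n⇒∣m+n p∣u-ts (∣m⇒∣m*n s p∣t))

data AdjModulo (k : ℤ) : ℤ × ℤ × ℤ → ℤ × ℤ × ℤ → Set where
  adj-mod : ∀ {x₁ x₂ x₃ y₁ y₂ y₃} →
    k ∣ x₂ + y₃ - x₁ * y₁ * y₁ → k ∣ x₃ + y₂ - x₁ * x₁ * y₁ →
    AdjModulo k (x₁ , x₂ , x₃) (y₁ , y₂ , y₃)

∣-alternating-sum : ∀ {k e₁ e₂ e₃ e₄} → k ∣ e₁ → k ∣ e₂ → k ∣ e₃ → k ∣ e₄ → k ∣ e₁ - e₂ - e₃ + e₄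
∣-alternating-sum k∣e₁ k∣e₂ k∣e₃ k∣e₄ = ∣m∣n⇒∣m+n (∣m∣n⇒∣m-n (∣m∣n⇒∣m-n k∣e₁ k∣e₂) k∣e₃) k∣e₄

private variable
  k α a₂ a₃ b₂ b₃ x₁ x₂ x₃ y₁ y₂ y₃ w₁ w₂ w₃ : ℤ

two-paths-differences :
  AdjModulo k (α , a₂ , a₃) (x₁ , x₂ , x₃) → AdjModulo k (x₁ , x₂ , x₃) (w₁ , w₂ , w₃) →
  AdjModulo k (α , b₂ , b₃) (y₁ , y₂ , y₃) → AdjModulo k (y₁ , y₂ , y₃) (w₁ , w₂ , w₃) →
  k ∣ (a₂ - b₂) - (α - w₁) * (x₁ - y₁) * (x₁ + y₁) ×
  k ∣ (a₃ - b₃) - (α - w₁) * (x₁ - y₁) * (α + w₁)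
two-paths-differences {k} {α} {a₂} {a₃} {x₁} {x₂} {x₃} {w₁} {w₂} {w₃} {b₂} {b₃} {y₁} {y₂} {y₃}
  (adj-mod ax ax′) (adj-mod xw xw′) (adj-mod by by′) (adj-mod yw yw′) =
  subst (k ∣_) (sym (second α a₂ b₂ x₁ x₃ y₁ y₃ w₁ w₂)) (∣-alternating-sum ax xw′ by yw′) ,
  subst (k ∣_) (sym (third α a₃ b₃ x₁ x₂ y₁ y₂ w₁ w₃)) (∣-alternating-sum ax′ xw by′ yw)
  where
  second : ∀ α a₂ b₂ x₁ x₃ y₁ y₃ w₁ w₂ →
    (a₂ - b₂) - (α - w₁) * (x₁ - y₁) * (x₁ + y₁) ≡
    (a₂ + x₃ - α * x₁ * x₁) - (x₃ + w₂ - x₁ * x₁ * w₁) - (b₂ + y₃ - α * y₁ * y₁) + (y₃ + w₂ - y₁ * y₁ * w₁)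
  second = solve-∀
  third : ∀ α a₃ b₃ x₁ x₂ y₁ y₂ w₁ w₃ →
    (a₃ - b₃) - (α - w₁) * (x₁ - y₁) * (α + w₁) ≡
    (a₃ + x₂ - α * α * x₁) - (x₂ + w₃ - x₁ * w₁ * w₁) - (b₃ + y₂ - α * α * y₁) + (y₂ + w₃ - y₁ * w₁ * w₁)
  third = solve-∀

∣∧<⇒≡0 : ∀ {n} → p ∣ℕ n → n < p → n ≡ 0
∣∧<⇒≡0 {n = zero}  _   _   = refl
∣∧<⇒≡0 {n = suc n} p∣n n<p = contradiction p∣n (>⇒∤ n<p)

module _ {p : ℕ} .{{_ : NonZero p}} where
  open Field p

  toℕ-ι : ∀ n → toℕ (ι n) ≡ n % p
  toℕ-ι n = toℕ-fromℕ< _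

  %≡%⇒∣- : ∀ m n → m % p ≡ n % p → + p ∣ + m - + n
  %≡%⇒∣- m n m%p≡n%p = divides (+ (m / p) - + (n / p)) (begin
    + m - + n
      ≡⟨ cong₂ (λ m′ n′ → + m′ - + n′) (m≡m%n+[m/n]*n m p) (m≡m%n+[m/n]*n n p) ⟩
    + (m % p ℕ.+ m / p ℕ.* p) - + (n % p ℕ.+ n / p ℕ.* p)
      ≡⟨ cong₂ _-_ (pos-r+q*p (m % p) (m / p)) (pos-r+q*p (n % p) (n / p)) ⟩
    (+ (m % p) + + (m / p) * + p) - (+ (n % p) + + (n / p) * + p)
      ≡⟨ cong (λ r → (r + + (m / p) * + p) - (+ (n % p) + + (n / p) * + p)) (cong +_ m%p≡n%p) ⟩
    (+ (n % p) + + (m / p) * + p) - (+ (n % p) + + (n / p) * + p)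
      ≡⟨ [r+a*p]-[r+b*p]≡[a-b]*p (+ (n % p)) (+ (m / p)) (+ (n / p)) (+ p) ⟩
    (+ (m / p) - + (n / p)) * + p ∎)
    where
    open ≡-Reasoning
    pos-r+q*p : ∀ r q → + (r ℕ.+ q ℕ.* p) ≡ + r + + q * + p
    pos-r+q*p r q = trans (ℤ.pos-+ r (q ℕ.* p)) (cong (λ qp → + r + qp) (ℤ.pos-* q p))
    [r+a*p]-[r+b*p]≡[a-b]*p : ∀ r a b P → (r + a * P) - (r + b * P) ≡ (a - b) * P
    [r+a*p]-[r+b*p]≡[a-b]*p = solve-∀

  ι≡ι⇒∣- : ∀ m n → ι m ≡ ι n → + p ∣ + m - + n
  ι≡ι⇒∣- m n ιm≡ιn = %≡%⇒∣- m n (trans (sym (toℕ-ι m)) (trans (cong toℕ ιm≡ιn) (toℕ-ι n)))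

  ι-⊗ : ∀ m n → ι m ⊗ ι n ≡ ι (m ℕ.* n)
  ι-⊗ m n = toℕ-injective (begin
    toℕ (ι m ⊗ ι n)                    ≡⟨ toℕ-fromℕ< _ ⟩
    (toℕ (ι m) ℕ.* toℕ (ι n)) % p      ≡⟨ cong₂ (λ a b → (a ℕ.* b) % p) (toℕ-ι m) (toℕ-ι n) ⟩
    ((m % p) ℕ.* (n % p)) % p          ≡⟨ %-distribˡ-* m n p ⟨
    (m ℕ.* n) % p                      ≡⟨ toℕ-ι (m ℕ.* n) ⟨
    toℕ (ι (m ℕ.* n))                  ∎)
    where open ≡-Reasoning

  ∣-residues⇒≡ : ∀ (i j : Fin p) → + p ∣ + toℕ i - + toℕ j → i ≡ j
  ∣-residues⇒≡ i j p∣i-j = toℕ-injective (ℤ.+-injective (ℤ.i-j≡0⇒i≡j _ _ (ℤ.∣i∣≡0⇒i≡0 ∣i-j∣≡0)))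
    where
    ∣i-j∣<p : ℤ.∣ + toℕ i - + toℕ j ∣ < p
    ∣i-j∣<p = subst (λ d → ℤ.∣ d ∣ < p) (sym (ℤ.[+m]-[+n]≡m⊖n (toℕ i) (toℕ j)))
      (ℕ.≤-<-trans (ℤ.∣m⊝n∣≤m⊔n (toℕ i) (toℕ j)) (ℕ.⊔-lub (toℕ<n i) (toℕ<n j)))
    ∣i-j∣≡0 : ℤ.∣ + toℕ i - + toℕ j ∣ ≡ 0
    ∣i-j∣≡0 = ∣∧<⇒≡0 (∣⇒∣ᵤ p∣i-j) ∣i-j∣<p

  ≡⇔∣-residues : ∀ (i j : Fin p) → i ≡ j ⇔ + p ∣ + toℕ i - + toℕ j
  ≡⇔∣-residues i j = mk⇔ (λ { refl → ∣-self }) (∣-residues⇒≡ i j)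
    where
    ∣-self : + p ∣ + toℕ i - + toℕ i
    ∣-self = divides 0ℤ (ℤ.+-inverseʳ (+ toℕ i))

  toℤ³ : Vertex p → ℤ × ℤ × ℤ
  toℤ³ v = + v₁ v , + toℕ (v₂ v) , + toℕ (v₃ v)

  ⊕≡ι⊗ι⊗ι⇒∣ : ∀ (u v : Fin p) l m n → u ⊕ v ≡ ι l ⊗ ι m ⊗ ι n →
    + p ∣ + toℕ u + + toℕ v - + l * + m * + n
  ⊕≡ι⊗ι⊗ι⇒∣ u v l m n u⊕v≡lmn = subst (+ p ∣_) (cong₂ _-_ (ℤ.pos-+ (toℕ u) (toℕ v)) pos-lmn)
    (ι≡ι⇒∣- (toℕ u ℕ.+ toℕ v) (l ℕ.* m ℕ.* n)
      (trans u⊕v≡lmn (trans (cong (_⊗ ι n) (ι-⊗ l m)) (ι-⊗ (l ℕ.* m) n))))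
    where
    pos-lmn : + (l ℕ.* m ℕ.* n) ≡ + l * + m * + n
    pos-lmn = trans (ℤ.pos-* (l ℕ.* m) n) (cong (_* + n) (ℤ.pos-* l m))

  Adj⇒AdjModulo : ∀ u v → Adj p u v → AdjModulo (+ p) (toℤ³ u) (toℤ³ v)
  Adj⇒AdjModulo u v (_ , e , e′) =
    adj-mod (⊕≡ι⊗ι⊗ι⇒∣ (v₂ u) (v₃ v) _ _ _ e) (⊕≡ι⊗ι⊗ι⇒∣ (v₃ u) (v₂ v) _ _ _ e′)

InS-+<p : ∀ {x y} → 5 ≤ p → InS p x → InS p y → x ℕ.+ y < p
InS-+<p {p} {x} {y} 5≤p (_ , x≤q , _) (_ , y≤q , _) = begin-strict
  x ℕ.+ y   ≤⟨ ℕ.+-mono-≤ x≤q y≤q ⟩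
  q ℕ.+ q   ≤⟨ ℕ.m≤m+n (q ℕ.+ q) (q ℕ.* 4) ⟩
  q ℕ.+ q ℕ.+ q ℕ.* 4 ≡⟨ q+q+4q≡6q q ⟩
  q ℕ.* 6   ≤⟨ m/n*n≤m (p ∸ 5) 6 ⟩
  p ∸ 5     <⟨ ℕ.∸-monoʳ-< (s≤s z≤n) 5≤p ⟩
  p         ∎
  where
  open ℕ.≤-Reasoning
  q : ℕ
  q = (p ∸ 5) / 6
  q+q+4q≡6q : ∀ q → q ℕ.+ q ℕ.+ q ℕ.* 4 ≡ q ℕ.* 6
  q+q+4q≡6q = ℕ-Solver.solve-∀

InS-+-∤ : ∀ {x y} → 5 ≤ p → InS p x → InS p y → ¬ + p ∣ + x + + y
InS-+-∤ {p} {suc x} {y} 5≤p x∈S@(s≤s _ , _) y∈S p∣x+y =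
  >⇒∤ (InS-+<p 5≤p x∈S y∈S) (∣⇒∣ᵤ (subst (+ p ∣_) (sym (ℤ.pos-+ (suc x) y)) p∣x+y))

same-v₁⇒v₂≢×v₃≢ : .{{_ : NonZero p}} → Prime p → 5 ≤ p → (a b x y w : Vertex p) →
  ¬ SameVertex a b → Adj p a x → Adj p x w → Adj p b y → Adj p y w →
  v₁ a ≡ v₁ b → (v₂ a ≢ v₂ b) × (v₃ a ≢ v₃ b)
same-v₁⇒v₂≢×v₃≢ {p} pp 5≤p a@(vtx α α∈S a₂ a₃) b@(vtx .α _ b₂ b₃) x y w a≉b ax xw by yw refl =
  (λ a₂≡b₂ → a≉b (refl , a₂≡b₂ , Equivalence.to v₂≡⇔v₃≡ a₂≡b₂)) ,
  (λ a₃≡b₃ → a≉b (refl , Equivalence.from v₂≡⇔v₃≡ a₃≡b₃ , a₃≡b₃))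
  where
  differences :
    + p ∣ (+ toℕ a₂ - + toℕ b₂) - (+ α - + v₁ w) * (+ v₁ x - + v₁ y) * (+ v₁ x + + v₁ y) ×
    + p ∣ (+ toℕ a₃ - + toℕ b₃) - (+ α - + v₁ w) * (+ v₁ x - + v₁ y) * (+ α + + v₁ w)
  differences = two-paths-differences
    (Adj⇒AdjModulo a x ax) (Adj⇒AdjModulo x w xw) (Adj⇒AdjModulo b y by) (Adj⇒AdjModulo y w yw)
  v₂≡⇔v₃≡ : a₂ ≡ b₂ ⇔ a₃ ≡ b₃
  v₂≡⇔v₃≡ = begin
    a₂ ≡ b₂                                     ≈⟨ ≡⇔∣-residues a₂ b₂ ⟩
    + p ∣ + toℕ a₂ - + toℕ b₂                   ≈⟨ ∣-cancel-factor pp (InS-+-∤ 5≤p (inS x) (inS y)) (proj₁ differences) ⟩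
    + p ∣ (+ α - + v₁ w) * (+ v₁ x - + v₁ y)    ≈⟨ ∣-cancel-factor pp (InS-+-∤ 5≤p α∈S (inS w)) (proj₂ differences) ⟨
    + p ∣ + toℕ a₃ - + toℕ b₃                   ≈⟨ ≡⇔∣-residues a₃ b₃ ⟨
    a₃ ≡ b₃                                     ∎
    where open SetoidReasoning (⇔.⇔-setoid 0ℓ)

lemma3p3 : (p : ℕ) → .{{_ : NonZero p}} → Prime p → 11 < p → p % 6 ≡ 5 →
  (a b c x y z w : Vertex p) →
  ¬ SameVertex a b → ¬ SameVertex a c → ¬ SameVertex b c →
  ¬ SameVertex x y → ¬ SameVertex x z → ¬ SameVertex x w →
  ¬ SameVertex y z → ¬ SameVertex y w → ¬ SameVertex z w →
  Adj p a x → Adj p x w → Adj p b y → Adj p y w → Adj p c z → Adj p z w →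
  ((v₁ a ≡ v₁ b → (v₂ a ≢ v₂ b) × (v₃ a ≢ v₃ b)) ×
   (v₁ a ≡ v₁ c → (v₂ a ≢ v₂ c) × (v₃ a ≢ v₃ c)) ×
   (v₁ b ≡ v₁ c → (v₂ b ≢ v₂ c) × (v₃ b ≢ v₃ c)))
lemma3p3 p pp 11<p _ a b c x y z w a≉b a≉c b≉c _ _ _ _ _ _ ax xw by yw cz zw =
  same-v₁⇒v₂≢×v₃≢ pp 5≤p a b x y w a≉b ax xw by yw ,
  same-v₁⇒v₂≢×v₃≢ pp 5≤p a c x z w a≉c ax xw cz zw ,
  same-v₁⇒v₂≢×v₃≢ pp 5≤p b c y z w b≉c by yw cz zw
  where
  5≤p : 5 ≤ p
  5≤p = ℕ.≤-trans (ℕ.m≤m+n 5 7) 11<p
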